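{- Let $S$ be a finite set of propositional clauses. Then $S$ is satisfiable if and only if there exists an inverter $\theta$ (a subset of the variables appearing in $S$) such that $S\theta$ is unipolar.
   Context: A literal is a variable $v$ or its negation $\neg v$. A clause is a finite set (disjunction) of literals. For a subset $\theta$ of the variables appearing in $S$ (called an \emph{inverter}), $S\theta$ denotes the set of clauses obtained from $S$ by replacing every literal $v$ with $\neg v$, and every literal $\neg v$ with $v$, for each $v\in\theta$. A clause is \emph{positive} if all its literals are unnegated and \emph{negative} if all its literals are negated. These conditions are read vacuously for the empty clause. A set of clauses is \emph{bipolar} if it contains both a positive clause and a negative clause, and \emph{unipolar} otherwise. -}

module Defs where

open import Data.Nat using (ℕ; _≟_)
open import Data.Bool using (Bool; true; false; not; if_then_else_)
open import Data.List using (List)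
open import Data.List.Relation.Unary.All using (All)
open import Data.List.Relation.Unary.Any using (Any)
open import Data.List.Membership.Propositional using (_∈_)
open import Data.List.Membership.DecPropositional _≟_ using (_∈?_)
open import Data.Product using (Σ; ∃; _×_; _,_)
open import Relation.Binary.PropositionalEquality using (_≡_)
open import Relation.Nullary.Decidable using (does)

Var : Set
Var = ℕ

record Literal : Set where
  constructor lit
  field
    var      : Var
    positive : Bool
open Literal public

-- A clause is a finite disjunction of literals (represented as a list;
-- order and repetitions are irrelevant to all notions below).
Clause : Set
Clause = List Literal

ClauseSet : Set
ClauseSet = List Clause

Assignment : Set
Assignment = Var → Bool

litValue : Assignment → Literal → Bool
litValue α (lit v true)  = α v
litValue α (lit v false) = not (α v)

SatClause : Assignment → Clause → Set
SatClause α C = Any (λ l → litValue α l ≡ true) C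

Satisfiable : ClauseSet → Set
Satisfiable S = ∃ λ (α : Assignment) → All (SatClause α) S

AppearsIn : Var → ClauseSet → Set
AppearsIn v S = Any (λ C → Any (λ l → var l ≡ v) C) S

Inverter : ClauseSet → Set
Inverter S = Σ (List Var) λ θ → All (λ v → AppearsIn v S) θ

invLit : List Var → Literal → Literal
invLit θ (lit v p) = lit v (if does (v ∈? θ) then not p else p)

invClause : List Var → Clause → Clause
invClause θ C = Data.List.map (invLit θ) C

invSet : List Var → ClauseSet → ClauseSet
invSet θ S = Data.List.map (invClause θ) S

-- Positive / negative clauses (vacuously true for the empty clause).
PositiveClause : Clause → Set
PositiveClause C = All (λ l → positive l ≡ true) C

NegativeClause : Clause → Set
NegativeClause C = All (λ l → positive l ≡ false) C

Bipolar : ClauseSet → Set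
Bipolar S = Any PositiveClause S × Any NegativeClause S

Unipolar : ClauseSet → Set
Unipolar S = Bipolar S → ⊥
  where open import Data.Empty using (⊥)

-- Inverting the variables of θ in an assignment α yields an assignment satisfying S exactly
-- when α satisfies Sθ. A unipolar set is satisfied by the constant assignment true (it has no
-- negative clause) or false (it has no positive clause). Conversely, if α satisfies S, let θ
-- be the variables of S that α makes true: inverting θ turns α into an assignment that
-- satisfies Sθ and is false on every variable of S, so each clause of Sθ has a true literal
-- over a false variable, i.e. a negated one, and Sθ has no positive clause.
module Submission where

open import Defs
open import Data.Product using (Σ; proj₁)
open import Function.Bundles using (_⇔_)

open import Data.Bool using (true; false; not; if_then_else_)
open import Data.Bool.Properties using (not-involutive; ¬-not) renaming (_≟_ to _≟ᵇ_)
open import Data.List using (List; map; concatMap; filter)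
open import Data.List.Relation.Unary.All as All using (All)
open import Data.List.Relation.Unary.All.Properties as All
  using (¬Any⇒All¬; All¬⇒¬Any; ¬All⇒Any¬)
open import Data.List.Relation.Unary.Any as Any using (Any)
open import Data.List.Relation.Unary.Any.Properties as Any using ()
open import Data.List.Membership.Propositional using (_∈_; lose)
open import Data.List.Membership.Propositional.Properties
  using (∈-map⁺; ∈-concatMap⁺; ∈-concatMap⁻; ∈-filter⁺; ∈-filter⁻)
open import Data.Nat using (_≟_)
open import Data.List.Membership.DecPropositional _≟_ using (_∈?_)
open import Data.Product using (_,_; proj₂)
open import Data.Empty using (⊥-elim)
open import Function using (_∘_)
open import Function.Bundles using (mk⇔)
open import Relation.Binary.PropositionalEquality
  using (_≡_; _≢_; refl; sym; trans; cong; module ≡-Reasoning)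
open import Relation.Nullary using (¬_; yes; no; does)
open import Relation.Unary using (Decidable)

invAssignment : List Var → Assignment → Assignment
invAssignment θ α v = if does (v ∈? θ) then not (α v) else α v

litValue-invAssignment : ∀ θ α l → litValue (invAssignment θ α) l ≡ litValue α (invLit θ l)
litValue-invAssignment θ α (lit v true) with does (v ∈? θ)
... | true  = refl
... | false = refl
litValue-invAssignment θ α (lit v false) with does (v ∈? θ)
... | true  = not-involutive (α v)
... | false = refl

invLit-involutive : ∀ θ l → invLit θ (invLit θ l) ≡ l
invLit-involutive θ (lit v p) with does (v ∈? θ)
... | true  = cong (lit v) (not-involutive p)
... | false = refl

satClause-invClause⁻ : ∀ θ α C →
  SatClause α (invClause θ C) → SatClause (invAssignment θ α) C
satClause-invClause⁻ θ α C =
  Any.map (λ {l} αl → trans (litValue-invAssignment θ α l) αl) ∘ Any.map⁻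

satClause-invClause⁺ : ∀ θ α C →
  SatClause α C → SatClause (invAssignment θ α) (invClause θ C)
satClause-invClause⁺ θ α C = Any.map⁺ ∘ Any.map λ {l} αl → begin
  litValue (invAssignment θ α) (invLit θ l) ≡⟨ litValue-invAssignment θ α (invLit θ l) ⟩
  litValue α (invLit θ (invLit θ l))        ≡⟨ cong (litValue α) (invLit-involutive θ l) ⟩
  litValue α l                              ≡⟨ αl ⟩
  true                                      ∎
  where open ≡-Reasoning

satisfiable-invSet⇒satisfiable : ∀ θ S → Satisfiable (invSet θ S) → Satisfiable S
satisfiable-invSet⇒satisfiable θ S (α , αSθ) =
  invAssignment θ α , All.map (satClause-invClause⁻ θ α _) (All.map⁻ αSθ)

litValue-false : ∀ l → positive l ≢ true → litValue (λ _ → false) l ≡ true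
litValue-false (lit v true)  l⁻ = ⊥-elim (l⁻ refl)
litValue-false (lit v false) _  = refl

litValue-true : ∀ l → positive l ≢ false → litValue (λ _ → true) l ≡ true
litValue-true (lit v true)  _  = refl
litValue-true (lit v false) l⁺ = ⊥-elim (l⁺ refl)

¬positive⇒satClause-false : ∀ C → ¬ PositiveClause C → SatClause (λ _ → false) C
¬positive⇒satClause-false C =
  Any.map (litValue-false _) ∘ ¬All⇒Any¬ (λ l → positive l ≟ᵇ true) C

¬negative⇒satClause-true : ∀ C → ¬ NegativeClause C → SatClause (λ _ → true) C
¬negative⇒satClause-true C =
  Any.map (litValue-true _) ∘ ¬All⇒Any¬ (λ l → positive l ≟ᵇ false) C

unipolar⇒satisfiable : ∀ S → Unipolar S → Satisfiable S
unipolar⇒satisfiable S unipolar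
  with Any.any? (All.all? (λ l → positive l ≟ᵇ true)) S
... | yes hasPositive = (λ _ → true) ,
  All.map (¬negative⇒satClause-true _)
          (¬Any⇒All¬ S (λ hasNegative → unipolar (hasPositive , hasNegative)))
... | no ¬hasPositive = (λ _ → false) ,
  All.map (¬positive⇒satClause-false _) (¬Any⇒All¬ S ¬hasPositive)

litValue-positive : ∀ β l → positive l ≡ true → litValue β l ≡ β (var l)
litValue-positive β (lit v true) _ = refl

satClause∧false⇒¬positive : ∀ β C → SatClause β C → All (λ l → β (var l) ≡ false) C →
  ¬ PositiveClause C
satClause∧false⇒¬positive β C βC βfalse positiveC
  with (βl≡false , l⁺) , βl ← All.lookupAny (All.zip (βfalse , positiveC)) βC
  with () ← trans (sym βl) (trans (litValue-positive β _ l⁺) βl≡false)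

vars : ClauseSet → List Var
vars = concatMap (map var)

∈-vars⁺ : ∀ {S C l} → C ∈ S → l ∈ C → var l ∈ vars S
∈-vars⁺ C∈S l∈C = ∈-concatMap⁺ (map var) (lose C∈S (∈-map⁺ var l∈C))

∈-vars⁻ : ∀ {S v} → v ∈ vars S → AppearsIn v S
∈-vars⁻ {S} = Any.map (Any.map sym ∘ Any.map⁻) ∘ ∈-concatMap⁻ (map var) {xs = S}

isTrue? : (α : Assignment) → Decidable (λ v → α v ≡ true)
isTrue? α v = α v ≟ᵇ true

trueVars : Assignment → ClauseSet → List Var
trueVars α S = filter (isTrue? α) (vars S)

trueVarsInverter : Assignment → (S : ClauseSet) → Inverter S
trueVarsInverter α S = trueVars α S , All.filter⁺ (isTrue? α) (All.tabulate ∈-vars⁻)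

invAssignment-trueVars : ∀ α S {v} → v ∈ vars S → invAssignment (trueVars α S) α v ≡ false
invAssignment-trueVars α S {v} v∈S with v ∈? trueVars α S
... | yes v∈θ = cong not (proj₂ (∈-filter⁻ (isTrue? α) {xs = vars S} v∈θ))
... | no  v∉θ = ¬-not (v∉θ ∘ ∈-filter⁺ (isTrue? α) v∈S)

satisfiable⇒unipolar-invSet : ∀ S → Satisfiable S →
  Σ (Inverter S) (λ θ → Unipolar (invSet (proj₁ θ) S))
satisfiable⇒unipolar-invSet S (α , αS) = trueVarsInverter α S , λ (hasPositive , _) →
  All¬⇒¬Any (All.map⁺ (All.tabulate ¬positive)) hasPositive
  where
  θ : List Var
  θ = trueVars α S
  ¬positive : ∀ {C} → C ∈ S → ¬ PositiveClause (invClause θ C)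
  ¬positive {C} C∈S = satClause∧false⇒¬positive (invAssignment θ α) (invClause θ C)
    (satClause-invClause⁺ θ α C (All.lookup αS C∈S))
    (All.map⁺ (All.tabulate (invAssignment-trueVars α S ∘ ∈-vars⁺ C∈S)))

proposition2p2 : (S : ClauseSet) →
    Satisfiable S ⇔ Σ (Inverter S) (λ θ → Unipolar (invSet (proj₁ θ) S))
proposition2p2 S = mk⇔ (satisfiable⇒unipolar-invSet S) λ ((θ , _) , unipolar) →
  satisfiable-invSet⇒satisfiable θ S (unipolar⇒satisfiable (invSet θ S) unipolar)
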